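{- $\min\{\mathrm{C}_0(f),\mathrm{C}_1(f)\}$ is not a lower bound on $\mathrm{Rank}(f)$: for every $n>4$, the symmetric function $f=\mathrm{MAJ}_n\vee\mathrm{PARITY}_n$ on $n$ variables satisfies $\mathrm{Rank}(f)<\min\{\mathrm{C}_0(f),\mathrm{C}_1(f)\}$.
   Context: $\mathrm{MAJ}_n(x)=1$ iff the Hamming weight of $x$ exceeds $n/2$; $\mathrm{PARITY}_n$ is XOR of the $n$ bits. For $a\in\{0,1\}^n$, $\mathrm{C}(f,a)$ is the minimum size of $S\subseteq[n]$ such that every $a'$ agreeing with $a$ on $S$ has $f(a')=f(a)$; $\mathrm{C}_b(f)=\max\{\mathrm{C}(f,a):a\in f^{ -1}(b)\}$. A decision tree queries single variables and has $0/1$ leaves. Rank of a rooted binary tree: leaves have rank $0$; an internal node with children of ranks $a,b$ has rank $a+1$ if $a=b$, else $\max\{a,b\}$; $\mathrm{Rank}(f)$ is the minimum rank of a decision tree computing $f$. -}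

module Defs where

open import Data.Nat using (ℕ; zero; suc; _+_; _<_; _⊔_)
open import Data.Nat.DivMod using (_/_)
open import Data.Bool using (Bool; true; false; _∨_; _xor_; if_then_else_)
open import Data.Fin using (Fin)
open import Data.Fin.Subset using (Subset; _∈_; ∣_∣)
open import Data.Product using (Σ; _×_; ∃; _,_)
open import Relation.Binary.PropositionalEquality using (_≡_)
open import Relation.Nullary.Decidable using (⌊_⌋)
open import Data.Nat using (_<?_)
import Relation.Nullary

BoolFun : ℕ → Set
BoolFun n = (Fin n → Bool) → Bool

weight : ∀ {n} → (Fin n → Bool) → ℕ
weight {zero}  x = 0
weight {suc n} x = (if x Data.Fin.zero then 1 else 0) + weight (λ i → x (Data.Fin.suc i))

-- MAJ_n(x) = 1 iff weight(x) > n/2, i.e. 2·weight(x) > n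
MAJ : (n : ℕ) → BoolFun n
MAJ n x = ⌊ n <? (weight x + weight x) ⌋

PARITY : (n : ℕ) → BoolFun n
PARITY zero    x = false
PARITY (suc n) x = x Data.Fin.zero xor PARITY n (λ i → x (Data.Fin.suc i))

MAJ∨PARITY : (n : ℕ) → BoolFun n
MAJ∨PARITY n x = MAJ n x ∨ PARITY n x

data DTree (n : ℕ) : Set where
  leaf : Bool → DTree n
  node : Fin n → DTree n → DTree n → DTree n

eval : ∀ {n} → DTree n → (Fin n → Bool) → Bool
eval (leaf b)       x = b
eval (node i t₀ t₁) x = if x i then eval t₁ x else eval t₀ x

rank : ∀ {n} → DTree n → ℕ
rank (leaf _) = 0
rank (node _ t₀ t₁) = combine (rank t₀) (rank t₁)
  where
  combine : ℕ → ℕ → ℕ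
  combine a b with a Data.Nat.≟ b
  ... | Relation.Nullary.yes _ = suc a
  ... | Relation.Nullary.no  _ = a ⊔ b

Computes : ∀ {n} → DTree n → BoolFun n → Set
Computes t f = ∀ x → eval t x ≡ f x

IsCertificate : ∀ {n} → BoolFun n → (Fin n → Bool) → Subset n → Set
IsCertificate f a S = ∀ a' → (∀ i → i ∈ S → a' i ≡ a i) → f a' ≡ f a

-- "r < C(f,a)": every certificate for f at a has size > r
BelowCa : ∀ {n} → ℕ → BoolFun n → (Fin n → Bool) → Set
BelowCa r f a = ∀ S → IsCertificate f a S → r < ∣ S ∣

-- "r < C_b(f)" (C_b(f) = max over a ∈ f⁻¹(b) of C(f,a)):
BelowCb : ∀ {n} → ℕ → Bool → BoolFun n → Set
BelowCb r b f = ∃ λ a → (f a ≡ b) × (BelowCa r f a)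

-- "Rank(f) < min{C₀(f), C₁(f)}": some decision tree computing f has rank
-- below both C₀(f) and C₁(f)  (Rank(f) is the minimum rank over such trees)
RankBelowMinCert : ∀ {n} → BoolFun n → Set
RankBelowMinCert f = ∃ λ t → Computes t f × BelowCb (rank t) false f × BelowCb (rank t) true f

-- Let n = k + 1. The decision tree queries x₀, x₁, …, x_{k-1} in turn as long
-- as the answers are 1, hanging a complete tree on the k remaining variables off
-- every 0-answer; once k ones have been seen the output is 1, since 2k > n makes
-- MAJ true. Every hanging tree has rank k and the spine below it has rank < k,
-- so the whole tree has rank k < n. On the other hand f is sensitive to every
-- coordinate both at the zero vector (flipping a bit makes PARITY true) and at
-- e₀ (flipping a bit gives weight 0 or 2, where MAJ and PARITY are both false
-- once n > 4); at such points every certificate is all of [n], so C₀ = C₁ = n.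
module Submission where

open import Defs
open import Data.Nat using (ℕ; zero; suc; _+_; _≤_; _<_; z≤n; s≤s; _≟_; _<?_)
open import Data.Nat.Properties
  using (≤-refl; ≤-trans; <⇒≤; +-suc; +-monoʳ-≤; +-mono-≤; +-monoˡ-≤; n≤1+n; m≤n⇒m≤1+n; ⊔-lub; ≤⇒≯)
open import Data.Bool using (Bool; true; false; not; _∨_; _xor_; if_then_else_)
open import Data.Bool.Properties using (not-involutive; ∨-zeroʳ)
open import Data.Fin using (Fin; inject₁)
import Data.Fin as Fin
open import Data.Fin.Subset using (Subset; _∈_; ∣_∣)
open import Data.Fin.Subset.Properties using (_∈?_; ⊆⊤; ⊆-antisym; ∣⊤∣≡n)
open import Data.Vec.Functional using (_∷_; head; tail)
open import Data.Product using (_,_)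
open import Function using (_∘_)
open import Relation.Binary.PropositionalEquality
open import Relation.Nullary using (yes; no; contradiction)
open import Relation.Nullary.Decidable using (isYes≗does; dec-true; dec-false)

private
  variable
    k m n : ℕ

-- Without function extensionality, respecting ≗ must be proved for each g.
Extensional : BoolFun n → Set
Extensional g = ∀ {x y} → x ≗ y → g x ≡ g y

∘∷-extensional : {g : BoolFun (suc n)} (c : Bool) → Extensional g → Extensional (g ∘ (c ∷_))
∘∷-extensional c ext x≗y = ext λ { Fin.zero → refl ; (Fin.suc i) → x≗y i }

∷-head-tail : (x : Fin (suc n) → Bool) → (head x ∷ tail x) ≗ x
∷-head-tail x Fin.zero    = refl
∷-head-tail x (Fin.suc i) = refl

rename : (Fin k → Fin m) → DTree k → DTree m
rename ρ (leaf b)       = leaf b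
rename ρ (node i t₀ t₁) = node (ρ i) (rename ρ t₀) (rename ρ t₁)

eval-rename : (ρ : Fin k → Fin m) (t : DTree k) (x : Fin m → Bool) →
              eval (rename ρ t) x ≡ eval t (x ∘ ρ)
eval-rename ρ (leaf b)       x = refl
eval-rename ρ (node i t₀ t₁) x with x (ρ i)
... | true  = eval-rename ρ t₁ x
... | false = eval-rename ρ t₀ x

rank-rename : (ρ : Fin k → Fin m) (t : DTree k) → rank (rename ρ t) ≡ rank t
rank-rename ρ (leaf b) = refl
rank-rename ρ (node i t₀ t₁) rewrite rank-rename ρ t₀ | rank-rename ρ t₁ = refl

rank-node-≤-suc : ∀ (i : Fin n) t₀ t₁ → rank t₀ ≤ m → rank t₁ ≤ m → rank (node i t₀ t₁) ≤ suc m
rank-node-≤-suc i t₀ t₁ r₀≤m r₁≤m with rank t₀ ≟ rank t₁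
... | yes _ = s≤s r₀≤m
... | no  _ = m≤n⇒m≤1+n (⊔-lub r₀≤m r₁≤m)

rank-node-≤ : ∀ (i : Fin n) t₀ t₁ → rank t₀ ≤ m → rank t₁ < m → rank (node i t₀ t₁) ≤ m
rank-node-≤ i t₀ t₁ r₀≤m r₁<m with rank t₀ ≟ rank t₁
... | yes r₀≡r₁ = subst (λ r → suc r ≤ _) (sym r₀≡r₁) r₁<m
... | no  _     = ⊔-lub r₀≤m (<⇒≤ r₁<m)

branch : (Bool → DTree n) → DTree (suc n)
branch t = node Fin.zero (rename Fin.suc (t false)) (rename Fin.suc (t true))

eval-branch : (t : Bool → DTree n) (x : Fin (suc n) → Bool) →
              eval (branch t) x ≡ eval (t (head x)) (tail x)
eval-branch t x with head x
... | true  = eval-rename Fin.suc (t true) x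
... | false = eval-rename Fin.suc (t false) x

computes-branch : {g : BoolFun (suc n)} (t : Bool → DTree n) → Extensional g →
                  (∀ c → Computes (t c) (g ∘ (c ∷_))) → Computes (branch t) g
computes-branch {g = g} t ext computes x = begin
  eval (branch t) x               ≡⟨ eval-branch t x ⟩
  eval (t (head x)) (tail x)      ≡⟨ computes (head x) (tail x) ⟩
  g (head x ∷ tail x)             ≡⟨ ext (∷-head-tail x) ⟩
  g x                             ∎
  where open ≡-Reasoning

rank-branch-≤-suc : (t : Bool → DTree n) → (∀ c → rank (t c) ≤ m) → rank (branch t) ≤ suc m
rank-branch-≤-suc t r≤m =
  rank-node-≤-suc Fin.zero (rename Fin.suc (t false)) (rename Fin.suc (t true))
  (subst (_≤ _) (sym (rank-rename Fin.suc (t false))) (r≤m false))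
  (subst (_≤ _) (sym (rank-rename Fin.suc (t true))) (r≤m true))

rank-branch-≤ : (t : Bool → DTree n) → rank (t false) ≤ m → rank (t true) < m → rank (branch t) ≤ m
rank-branch-≤ t r₀≤m r₁<m =
  rank-node-≤ Fin.zero (rename Fin.suc (t false)) (rename Fin.suc (t true))
  (subst (_≤ _) (sym (rank-rename Fin.suc (t false))) r₀≤m)
  (subst (_< _) (sym (rank-rename Fin.suc (t true))) r₁<m)

completeTree : (n : ℕ) → BoolFun n → DTree n
completeTree zero    g = leaf (g λ ())
completeTree (suc n) g = branch λ c → completeTree n (g ∘ (c ∷_))

rank-completeTree : (n : ℕ) (g : BoolFun n) → rank (completeTree n g) ≤ n
rank-completeTree zero    g = z≤n
rank-completeTree (suc n) g = rank-branch-≤-suc (λ c → completeTree n (g ∘ (c ∷_))) λ c →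
  rank-completeTree n (g ∘ (c ∷_))

computes-completeTree : (n : ℕ) {g : BoolFun n} → Extensional g → Computes (completeTree n g) g
computes-completeTree zero    ext x = ext λ ()
computes-completeTree (suc n) {g} ext =
  computes-branch (λ c → completeTree n (g ∘ (c ∷_))) ext λ c →
    computes-completeTree n (∘∷-extensional c ext)

spineTree : (k : ℕ) → Bool → BoolFun (suc k) → DTree (suc k)
spineChildren : (k : ℕ) → Bool → BoolFun (suc (suc k)) → Bool → DTree (suc k)

spineTree zero    b g = leaf b
spineTree (suc k) b g = branch (spineChildren k b g)

spineChildren k b g true  = spineTree k b (g ∘ (true ∷_))
spineChildren k b g false = completeTree (suc k) (g ∘ (false ∷_))

rank-spineTree : (k : ℕ) (b : Bool) (g : BoolFun (suc k)) → rank (spineTree k b g) ≤ k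
rank-spineTree zero    b g = z≤n
rank-spineTree (suc k) b g = rank-branch-≤ (spineChildren k b g)
  (rank-completeTree (suc k) (g ∘ (false ∷_)))
  (s≤s (rank-spineTree k b (g ∘ (true ∷_))))

computes-spineTree : (k : ℕ) (b : Bool) {g : BoolFun (suc k)} → Extensional g →
                     (∀ x → (∀ i → x (inject₁ i) ≡ true) → g x ≡ b) → Computes (spineTree k b g) g
computes-spineTree zero    b ext onesPrefix⇒b x = sym (onesPrefix⇒b x λ ())
computes-spineTree (suc k) b {g} ext onesPrefix⇒b = computes-branch (spineChildren k b g) ext child
  where
  child : ∀ c → Computes (spineChildren k b g c) (g ∘ (c ∷_))
  child true  = computes-spineTree k b (∘∷-extensional true ext) λ y ones →
    onesPrefix⇒b (true ∷ y) λ { Fin.zero → refl ; (Fin.suc i) → ones i }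
  child false = computes-completeTree (suc k) (∘∷-extensional false ext)

flip : (Fin n → Bool) → Fin n → (Fin n → Bool)
flip a Fin.zero    = not (head a) ∷ tail a
flip a (Fin.suc i) = head a ∷ flip (tail a) i

flip-≢ : (a : Fin n → Bool) {i j : Fin n} → i ≢ j → flip a i j ≡ a j
flip-≢ a {Fin.zero}  {Fin.zero}  i≢j = contradiction refl i≢j
flip-≢ a {Fin.zero}  {Fin.suc j} i≢j = refl
flip-≢ a {Fin.suc i} {Fin.zero}  i≢j = refl
flip-≢ a {Fin.suc i} {Fin.suc j} i≢j = flip-≢ (tail a) (i≢j ∘ cong Fin.suc)

FullySensitive : BoolFun n → (Fin n → Bool) → Set
FullySensitive f a = ∀ i → f (flip a i) ≢ f a

certificate-∋-sensitive : {f : BoolFun n} {a : Fin n → Bool} {S : Subset n} (i : Fin n) →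
                          f (flip a i) ≢ f a → IsCertificate f a S → i ∈ S
certificate-∋-sensitive {a = a} {S} i sensitive certificate with i ∈? S
... | yes i∈S = i∈S
... | no  i∉S = contradiction (certificate (flip a i) agrees) sensitive
  where
  agrees : ∀ j → j ∈ S → flip a i j ≡ a j
  agrees j j∈S = flip-≢ a {i} {j} λ { refl → i∉S j∈S }

fullySensitive⇒BelowCa : {f : BoolFun n} {a : Fin n → Bool} {r : ℕ} →
                         r < n → FullySensitive f a → BelowCa r f a
fullySensitive⇒BelowCa {n} r<n sensitive S certificate = subst (_ <_) (sym ∣S∣≡n) r<n
  where
  ∣S∣≡n : ∣ S ∣ ≡ n
  ∣S∣≡n = trans (cong ∣_∣ (⊆-antisym ⊆⊤ λ {i} _ → certificate-∋-sensitive i (sensitive i) certificate))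
                (∣⊤∣≡n n)

weight-cong : {x y : Fin n → Bool} → x ≗ y → weight x ≡ weight y
weight-cong {zero}  x≗y = refl
weight-cong {suc n} {x} {y} x≗y rewrite x≗y Fin.zero =
  cong ((if y Fin.zero then 1 else 0) +_) (weight-cong (x≗y ∘ Fin.suc))

PARITY-cong : {x y : Fin n → Bool} → x ≗ y → PARITY n x ≡ PARITY n y
PARITY-cong {zero}  x≗y = refl
PARITY-cong {suc n} {x} {y} x≗y rewrite x≗y Fin.zero =
  cong (y Fin.zero xor_) (PARITY-cong (x≗y ∘ Fin.suc))

MAJ∨PARITY-extensional : (n : ℕ) → Extensional (MAJ∨PARITY n)
MAJ∨PARITY-extensional n x≗y rewrite weight-cong x≗y | PARITY-cong {n} x≗y = refl

MAJ-true : (n : ℕ) {x : Fin n → Bool} → n < weight x + weight x → MAJ n x ≡ true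
MAJ-true n n<2w = trans (isYes≗does (n <? _)) (dec-true (n <? _) n<2w)

MAJ-false : (n : ℕ) {x : Fin n → Bool} → weight x + weight x ≤ n → MAJ n x ≡ false
MAJ-false n 2w≤n = trans (isYes≗does (n <? _)) (dec-false (n <? _) (≤⇒≯ 2w≤n))

weight-flip-≤ : (a : Fin n → Bool) (i : Fin n) → weight (flip a i) ≤ suc (weight a)
weight-flip-≤ a Fin.zero with a Fin.zero
... | true  = m≤n⇒m≤1+n (n≤1+n _)
... | false = ≤-refl
weight-flip-≤ a (Fin.suc i) = subst (c + weight (flip (tail a) i) ≤_) (+-suc c (weight (tail a)))
  (+-monoʳ-≤ c (weight-flip-≤ (tail a) i))
  where
  c = if head a then 1 else 0

PARITY-flip : (a : Fin n → Bool) (i : Fin n) → PARITY n (flip a i) ≡ not (PARITY n a)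
PARITY-flip {suc n} a Fin.zero with a Fin.zero
... | true  = sym (not-involutive _)
... | false = refl
PARITY-flip {suc n} a (Fin.suc i) rewrite PARITY-flip (tail a) i with a Fin.zero
... | true  = refl
... | false = refl

weight-≥-onesPrefix : (x : Fin (suc k) → Bool) → (∀ i → x (inject₁ i) ≡ true) → k ≤ weight x
weight-≥-onesPrefix {zero}  x ones = z≤n
weight-≥-onesPrefix {suc k} x ones rewrite ones Fin.zero =
  s≤s (weight-≥-onesPrefix (tail x) (ones ∘ Fin.suc))

zeros : Fin n → Bool
zeros _ = false

weight-zeros : (n : ℕ) → weight (zeros {n}) ≡ 0
weight-zeros zero    = refl
weight-zeros (suc n) = weight-zeros n

PARITY-zeros : (n : ℕ) → PARITY n zeros ≡ false
PARITY-zeros zero    = refl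
PARITY-zeros (suc n) = PARITY-zeros n

PARITY-flip-zeros : (n : ℕ) (i : Fin n) → PARITY n (flip zeros i) ≡ true
PARITY-flip-zeros n i = trans (PARITY-flip zeros i) (cong not (PARITY-zeros n))

weight-flip-flip-zeros : (n : ℕ) (i j : Fin n) → weight (flip (flip zeros i) j) ≤ 2
weight-flip-flip-zeros n i j = ≤-trans (weight-flip-≤ _ j)
  (s≤s (subst (λ w → weight (flip zeros i) ≤ suc w) (weight-zeros n) (weight-flip-≤ zeros i)))

MAJ∨PARITY-zeros : (n : ℕ) → MAJ∨PARITY n zeros ≡ false
MAJ∨PARITY-zeros n = cong₂ _∨_
  (MAJ-false n (subst (λ w → w + w ≤ n) (sym (weight-zeros n)) z≤n))
  (PARITY-zeros n)

MAJ∨PARITY-flip-zeros : (n : ℕ) (i : Fin n) → MAJ∨PARITY n (flip zeros i) ≡ true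
MAJ∨PARITY-flip-zeros n i = trans (cong (MAJ n (flip zeros i) ∨_) (PARITY-flip-zeros n i)) (∨-zeroʳ _)

MAJ∨PARITY-flip-flip-zeros : (n : ℕ) → 4 ≤ n → (i j : Fin n) →
                             MAJ∨PARITY n (flip (flip zeros i) j) ≡ false
MAJ∨PARITY-flip-flip-zeros n 4≤n i j = cong₂ _∨_
  (MAJ-false n (≤-trans (+-mono-≤ w≤2 w≤2) 4≤n))
  (trans (PARITY-flip (flip zeros i) j) (cong not (PARITY-flip-zeros n i)))
  where
  w≤2 : weight (flip (flip zeros i) j) ≤ 2
  w≤2 = weight-flip-flip-zeros n i j

MAJ∨PARITY-onesPrefix : (k : ℕ) → 2 ≤ k → (x : Fin (suc k) → Bool) →
                        (∀ i → x (inject₁ i) ≡ true) → MAJ∨PARITY (suc k) x ≡ true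
MAJ∨PARITY-onesPrefix k 2≤k x ones =
  cong (_∨ PARITY (suc k) x) (MAJ-true (suc k) {x} (≤-trans (+-monoˡ-≤ k 2≤k) (+-mono-≤ k≤w k≤w)))
  where
  k≤w : k ≤ weight x
  k≤w = weight-≥-onesPrefix x ones

lemma5p5 : (n : ℕ) → 4 < n → RankBelowMinCert (MAJ∨PARITY n)
lemma5p5 (suc k) (s≤s 4≤k) =
  tree , computes ,
  (zeros , f-zeros , fullySensitive⇒BelowCa rank<n sensitive-zeros) ,
  (e₀ , f-flip-zeros Fin.zero , fullySensitive⇒BelowCa rank<n sensitive-e₀)
  where
  f : BoolFun (suc k)
  f = MAJ∨PARITY (suc k)
  e₀ : Fin (suc k) → Bool
  e₀ = flip zeros Fin.zero
  f-zeros : f zeros ≡ false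
  f-zeros = MAJ∨PARITY-zeros (suc k)
  f-flip-zeros : ∀ i → f (flip zeros i) ≡ true
  f-flip-zeros = MAJ∨PARITY-flip-zeros (suc k)
  tree : DTree (suc k)
  tree = spineTree k true f
  computes : Computes tree f
  computes = computes-spineTree k true (MAJ∨PARITY-extensional (suc k))
    (MAJ∨PARITY-onesPrefix k (≤-trans (s≤s (s≤s z≤n)) 4≤k))
  rank<n : rank tree < suc k
  rank<n = s≤s (rank-spineTree k true f)
  sensitive-zeros : FullySensitive f zeros
  sensitive-zeros i = subst₂ _≢_ (sym (f-flip-zeros i)) (sym f-zeros) λ ()
  sensitive-e₀ : FullySensitive f e₀
  sensitive-e₀ i = subst₂ _≢_
    (sym (MAJ∨PARITY-flip-flip-zeros (suc k) (m≤n⇒m≤1+n 4≤k) Fin.zero i))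
    (sym (f-flip-zeros Fin.zero)) λ ()
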